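{- Let $G$ be a (finite simple undirected) graph. The following are equivalent: (a) $G$ is the competition-common enemy graph of a semiorder; (b) $G$ is the competition-common enemy graph of an interval order; (c) $G$ is (isomorphic to) $K_r \cup I_q$, the disjoint union of a complete graph on $r$ vertices and an edgeless graph on $q$ vertices, for some nonnegative integers $r,q$, where if $r \geq 2$ then $q \geq 2$.
   Context: All digraphs are finite. For a digraph $D$ and a vertex $x$, $N^+_D(x)=\{v \mid (x,v)\in A(D)\}$ is the set of out-neighbors and $N^-_D(x)=\{v \mid (v,x)\in A(D)\}$ the set of in-neighbors of $x$. The competition-common enemy graph of $D$ is the simple undirected graph with vertex set $V(D)$ in which two distinct vertices $x,y$ are adjacent if and only if both $N^+_D(x)\cap N^+_D(y)\neq\emptyset$ and $N^-_D(x)\cap N^-_D(y)\neq\emptyset$. A digraph $D=(V,A)$ is a semiorder if there exist a function $f:V\to\mathbb{R}$ and a real $\delta>0$ such that $(x,y)\in A$ if and only if $f(x)>f(y)+\delta$. A digraph $D=(V,A)$ is an interval order if there is an assignment of a closed real interval $J(x)\subset\mathbb{R}$ to each $x\in V$ such that $(x,y)\in A$ if and only if $\min J(x)>\max J(y)$. $K_r$ denotes the complete graph on $r$ vertices and $I_q$ the graph with $q$ vertices and no edges.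
   Formalization: The semiorder function f, the threshold δ and the endpoints of the intervals J(x) take values in the rationals instead of the reals. -}

module Defs where

open import Level using (0ℓ)
open import Data.Nat using (ℕ) renaming (_≤_ to _≤ℕ_)
open import Data.Fin using (Fin)
open import Data.Sum using (_⊎_; inj₁; inj₂)
open import Data.Product using (Σ; _×_; ∃; ∃-syntax)
open import Data.Empty using (⊥)
open import Data.Unit using (⊤)
open import Relation.Nullary using (¬_)
open import Relation.Binary.PropositionalEquality using (_≡_; _≢_; sym; refl)
open import Function.Bundles using (_⇔_; _⤖_; Bijection)
open import Data.Rational using (ℚ; 0ℚ; _+_; _<_; _≤_)

record Graph (V : Set) : Set₁ where
  field
    Adj    : V → V → Set
    symm   : ∀ {x y} → Adj x y → Adj y x
    irrefl : ∀ {x} → ¬ Adj x x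
open Graph public

record Digraph (V : Set) : Set₁ where
  field
    Arc : V → V → Set
open Digraph public

CommonOut : {V : Set} → Digraph V → V → V → Set
CommonOut D x y = ∃[ v ] (Arc D x v × Arc D y v)

CommonIn : {V : Set} → Digraph V → V → V → Set
CommonIn D x y = ∃[ v ] (Arc D v x × Arc D v y)

IsCCEGraphOf : {V : Set} → Graph V → Digraph V → Set
IsCCEGraphOf {V} G D =
  ∀ (x y : V) → x ≢ y → (Adj G x y ⇔ (CommonOut D x y × CommonIn D x y))

IsSemiorder : {V : Set} → Digraph V → Set
IsSemiorder {V} D =
  Σ (V → ℚ) λ f → Σ ℚ λ δ →
    (0ℚ < δ) × (∀ (x y : V) → (Arc D x y ⇔ (f y + δ < f x)))

IsIntervalOrder : {V : Set} → Digraph V → Set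
IsIntervalOrder {V} D =
  Σ (V → ℚ) λ lo → Σ (V → ℚ) λ hi →
    (∀ x → lo x ≤ hi x) × (∀ (x y : V) → (Arc D x y ⇔ (hi y < lo x)))

KI-Adj : (r q : ℕ) → Fin r ⊎ Fin q → Fin r ⊎ Fin q → Set
KI-Adj r q (inj₁ i) (inj₁ j) = i ≢ j
KI-Adj r q _        _        = ⊥

KI : (r q : ℕ) → Graph (Fin r ⊎ Fin q)
KI r q = record { Adj = KI-Adj r q ; symm = sy ; irrefl = irr }
  where
    sy : ∀ {x y} → KI-Adj r q x y → KI-Adj r q y x
    sy {inj₁ i} {inj₁ j} p e = p (sym e)
    sy {inj₁ _} {inj₂ _} ()
    sy {inj₂ _} {_} ()
    irr : ∀ {x} → ¬ KI-Adj r q x x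
    irr {inj₁ i} p = p refl
    irr {inj₂ _} ()

_≅_ : {V W : Set} → Graph V → Graph W → Set
_≅_ {V} {W} G H =
  Σ (V ⤖ W) λ φ → ∀ x y → (Adj G x y ⇔ Adj H (Bijection.to φ x) (Bijection.to φ y))

{-# OPTIONS --safe #-}
-- In an interval order, two vertices that both have an out-neighbour have a
-- common one (the out-neighbour whose interval ends first), and dually for
-- in-neighbours.  So the competition-common enemy graph is the complete graph
-- on the inner vertices (those with both an in- and an out-neighbour), and all
-- other vertices are isolated.  If there is an inner vertex x, the vertex whose
-- interval ends first lies below x and the one whose interval starts last lies
-- above x; neither is inner, and they are distinct because the order is
-- irreflexive and transitive, whence q ≥ 2.  Conversely K_r ∪ I_q is realised
-- by the semiorder with threshold ½ that puts the clique at level 1, one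
-- isolated vertex at level 2 and the remaining ones at level 0.

module Submission where

open import Defs
open import Data.Nat using (ℕ; _+_; _≤_)
open import Data.Fin using (Fin)
open import Data.Product using (Σ; _×_; ∃-syntax)
open import Function.Bundles using (_⇔_)
open import Data.Nat using (suc; zero; s≤s; z≤n)
open import Data.Fin using (zero; suc; fromℕ<)
open import Data.Fin.Properties using (any?)
open import Data.Product using (_,_; proj₁; proj₂; ∃)
import Data.Product as Product
open import Data.Sum using (_⊎_; inj₁; inj₂; map; map₁; map₂)
open import Data.Unit using (⊤; tt)
open import Data.Empty using (⊥; ⊥-elim)
open import Data.List using (allFin)
open import Data.List.Relation.Unary.All using (lookup)
open import Data.List.Membership.Propositional.Properties using (∈-allFin)
import Data.List.Extrema
open import Data.Rational as ℚ using (ℚ; 0ℚ; 1ℚ; ½; _/_)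
open import Data.Integer using (+_)
open import Data.Rational.Properties
  using (≤-decTotalOrder; ≤-total; <⇒≤; <-irrefl; <-≤-trans; ≤-<-trans; <-trans; _<?_;
         +-monoʳ-≤; +-identityʳ)
open import Relation.Binary.Bundles using (DecTotalOrder)
open import Relation.Unary using (Pred; Decidable)
open import Relation.Nullary using (¬_; Dec; yes; no)
open import Relation.Nullary.Decidable using (_×-dec_; from-yes; from-no)
import Relation.Nullary.Decidable as Dec
open import Relation.Binary.PropositionalEquality using (_≡_; _≢_; refl; sym; trans; cong; subst)
open import Function using (_∘_; id)
open import Function.Bundles using (mk⇔; Equivalence; Bijection; mk↔ₛ′; _⤖_)
open import Function.Definitions using (StrictlySurjective)
open import Function.Properties.Inverse using (↔⇒⤖)
open import Function.Construct.Composition using (_⇔-∘_)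
open import Function.Construct.Symmetry using (⇔-sym)
open import Data.Product.Function.NonDependent.Propositional using (_×-⇔_)
open import Function.Related.Propositional using (module EquationalReasoning)

private
  variable
    V W : Set

≢⇒2≤ : ∀ {m} {i j : Fin m} → i ≢ j → 2 ≤ m
≢⇒2≤ {suc zero} {zero} {zero} i≢j = ⊥-elim (i≢j refl)
≢⇒2≤ {suc (suc _)} _ = s≤s (s≤s z≤n)

IsInj₁ : {A B : Set} → A ⊎ B → Set
IsInj₁ (inj₁ _) = ⊤
IsInj₁ (inj₂ _) = ⊥

IsInj₁-map : {A B C D : Set} {f : A → C} {g : B → D} (u : A ⊎ B) → IsInj₁ (map f g u) ⇔ IsInj₁ u
IsInj₁-map (inj₁ _) = mk⇔ id id
IsInj₁-map (inj₂ _) = mk⇔ id id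

inj₂-distinct⇒2≤ : ∀ {r q} {u v : Fin r ⊎ Fin q} → ¬ IsInj₁ u → ¬ IsInj₁ v → u ≢ v → 2 ≤ q
inj₂-distinct⇒2≤ {u = inj₁ _} ¬u _ _ = ⊥-elim (¬u tt)
inj₂-distinct⇒2≤ {u = inj₂ _} {inj₁ _} _ ¬v _ = ⊥-elim (¬v tt)
inj₂-distinct⇒2≤ {u = inj₂ _} {inj₂ _} _ _ u≢v = ≢⇒2≤ (u≢v ∘ cong inj₂)

record Partition {n : ℕ} (P : Pred (Fin n) _) : Set where
  field
    r q     : ℕ
    to      : Fin n → Fin r ⊎ Fin q
    from    : Fin r ⊎ Fin q → Fin n
    to∘from : ∀ u → to (from u) ≡ u
    from∘to : ∀ x → from (to x) ≡ x
    inj₁⇔   : ∀ x → IsInj₁ (to x) ⇔ P x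

  bijection : Fin n ⤖ (Fin r ⊎ Fin q)
  bijection = ↔⇒⤖ (mk↔ₛ′ to from to∘from from∘to)

  to-injective : ∀ {x y} → to x ≡ to y → x ≡ y
  to-injective {x} {y} tx≡ty = trans (sym (from∘to x)) (trans (cong from tx≡ty) (from∘to y))

module _ {n : ℕ} {P : Pred (Fin (suc n)) _} (Π : Partition (P ∘ suc)) where
  private module Π = Partition Π

  consInj₁ : P zero → Partition P
  consInj₁ p = record
    { to = to ; from = from ; to∘from = to∘from ; from∘to = from∘to ; inj₁⇔ = inj₁⇔ }
    where
    to : Fin (suc n) → Fin (suc Π.r) ⊎ Fin Π.q
    to zero    = inj₁ zero
    to (suc i) = map₁ suc (Π.to i)

    from : Fin (suc Π.r) ⊎ Fin Π.q → Fin (suc n)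
    from (inj₁ zero)    = zero
    from (inj₁ (suc j)) = suc (Π.from (inj₁ j))
    from (inj₂ k)       = suc (Π.from (inj₂ k))

    from-map₁ : ∀ u → from (map₁ suc u) ≡ suc (Π.from u)
    from-map₁ (inj₁ _) = refl
    from-map₁ (inj₂ _) = refl

    to∘from : ∀ u → to (from u) ≡ u
    to∘from (inj₁ zero)    = refl
    to∘from (inj₁ (suc j)) = cong (map₁ suc) (Π.to∘from (inj₁ j))
    to∘from (inj₂ k)       = cong (map₁ suc) (Π.to∘from (inj₂ k))

    from∘to : ∀ x → from (to x) ≡ x
    from∘to zero    = refl
    from∘to (suc i) = trans (from-map₁ (Π.to i)) (cong suc (Π.from∘to i))

    inj₁⇔ : ∀ x → IsInj₁ (to x) ⇔ P x
    inj₁⇔ zero    = mk⇔ (λ _ → p) (λ _ → tt)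
    inj₁⇔ (suc i) = Π.inj₁⇔ i ⇔-∘ IsInj₁-map (Π.to i)

  consInj₂ : ¬ P zero → Partition P
  consInj₂ ¬p = record
    { to = to ; from = from ; to∘from = to∘from ; from∘to = from∘to ; inj₁⇔ = inj₁⇔ }
    where
    to : Fin (suc n) → Fin Π.r ⊎ Fin (suc Π.q)
    to zero    = inj₂ zero
    to (suc i) = map₂ suc (Π.to i)

    from : Fin Π.r ⊎ Fin (suc Π.q) → Fin (suc n)
    from (inj₁ j)       = suc (Π.from (inj₁ j))
    from (inj₂ zero)    = zero
    from (inj₂ (suc k)) = suc (Π.from (inj₂ k))

    from-map₂ : ∀ u → from (map₂ suc u) ≡ suc (Π.from u)
    from-map₂ (inj₁ _) = refl
    from-map₂ (inj₂ _) = refl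

    to∘from : ∀ u → to (from u) ≡ u
    to∘from (inj₁ j)       = cong (map₂ suc) (Π.to∘from (inj₁ j))
    to∘from (inj₂ zero)    = refl
    to∘from (inj₂ (suc k)) = cong (map₂ suc) (Π.to∘from (inj₂ k))

    from∘to : ∀ x → from (to x) ≡ x
    from∘to zero    = refl
    from∘to (suc i) = trans (from-map₂ (Π.to i)) (cong suc (Π.from∘to i))

    inj₁⇔ : ∀ x → IsInj₁ (to x) ⇔ P x
    inj₁⇔ zero    = mk⇔ ⊥-elim (⊥-elim ∘ ¬p)
    inj₁⇔ (suc i) = Π.inj₁⇔ i ⇔-∘ IsInj₁-map (Π.to i)

partition : ∀ {n} {P : Pred (Fin n) _} → Decidable P → Partition P
partition {zero} _ = record
  { r = 0 ; q = 0 ; to = λ () ; from = λ { (inj₁ ()) ; (inj₂ ()) }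
  ; to∘from = λ { (inj₁ ()) ; (inj₂ ()) } ; from∘to = λ () ; inj₁⇔ = λ () }
partition {suc n} P? with P? zero
... | yes p = consInj₁ (partition (P? ∘ suc)) p
... | no ¬p = consInj₂ (partition (P? ∘ suc)) ¬p

KI-Adj⇔IsInj₁ : ∀ {r q} {u v : Fin r ⊎ Fin q} → u ≢ v → KI-Adj r q u v ⇔ (IsInj₁ u × IsInj₁ v)
KI-Adj⇔IsInj₁ {u = inj₁ _} {inj₁ _} u≢v = mk⇔ (λ _ → tt , tt) (λ _ → u≢v ∘ cong inj₁)
KI-Adj⇔IsInj₁ {u = inj₁ _} {inj₂ _} _   = mk⇔ (λ ()) (λ ())
KI-Adj⇔IsInj₁ {u = inj₂ _} {_}      _   = mk⇔ (λ ()) (λ ())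

KI-Adj⇒2≤r : ∀ {r q} {u v : Fin r ⊎ Fin q} → KI-Adj r q u v → 2 ≤ r
KI-Adj⇒2≤r {u = inj₁ _} {inj₁ _} = ≢⇒2≤

adj⇒≢ : (G : Graph V) → ∀ {x y} → Adj G x y → x ≢ y
adj⇒≢ G a refl = irrefl G a

HasOut HasIn Inner : Digraph V → Pred V _
HasOut D x = ∃ (Arc D x)
HasIn  D x = ∃ λ w → Arc D w x
Inner  D x = HasOut D x × HasIn D x

common⇒inner : {D : Digraph V} {x y : V} →
               CommonOut D x y × CommonIn D x y → Inner D x × Inner D y
common⇒inner ((v , xv , yv) , (w , wx , wy)) = ((v , xv) , (w , wx)) , ((v , yv) , (w , wy))

module IntervalOrder {D : Digraph V} (io : IsIntervalOrder D) where

  lo hi : V → ℚ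
  lo = proj₁ io
  hi = proj₁ (proj₂ io)

  private
    lo≤hi : ∀ x → lo x ℚ.≤ hi x
    lo≤hi = proj₁ (proj₂ (proj₂ io))

    arc⇔ : ∀ x y → Arc D x y ⇔ (hi y ℚ.< lo x)
    arc⇔ = proj₂ (proj₂ (proj₂ io))

  arc⇒< : ∀ {x y} → Arc D x y → hi y ℚ.< lo x
  arc⇒< = Equivalence.to (arc⇔ _ _)

  <⇒arc : ∀ {x y} → hi y ℚ.< lo x → Arc D x y
  <⇒arc = Equivalence.from (arc⇔ _ _)

  arc? : ∀ x y → Dec (Arc D x y)
  arc? x y = Dec.map (⇔-sym (arc⇔ x y)) (hi y <? lo x)

  arc-irrefl : ∀ {x} → ¬ Arc D x x
  arc-irrefl {x} xx = <-irrefl refl (<-≤-trans (arc⇒< xx) (lo≤hi x))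

  arc-trans : ∀ {x y z} → Arc D x y → Arc D y z → Arc D x z
  arc-trans {y = y} xy yz = <⇒arc (<-trans (<-≤-trans (arc⇒< yz) (lo≤hi y)) (arc⇒< xy))

  arc-shrinkʳ : ∀ {x y z} → Arc D x y → hi z ℚ.≤ hi y → Arc D x z
  arc-shrinkʳ xy z≤y = <⇒arc (≤-<-trans z≤y (arc⇒< xy))

  arc-growˡ : ∀ {x y z} → Arc D x y → lo x ℚ.≤ lo z → Arc D z y
  arc-growˡ xy x≤z = <⇒arc (<-≤-trans (arc⇒< xy) x≤z)

  commonOut : ∀ {x y} → HasOut D x → HasOut D y → CommonOut D x y
  commonOut (a , xa) (b , yb) with ≤-total (hi a) (hi b)
  ... | inj₁ a≤b = a , xa , arc-shrinkʳ yb a≤b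
  ... | inj₂ b≤a = b , arc-shrinkʳ xa b≤a , yb

  commonIn : ∀ {x y} → HasIn D x → HasIn D y → CommonIn D x y
  commonIn (c , cx) (d , dy) with ≤-total (lo c) (lo d)
  ... | inj₁ c≤d = d , arc-growˡ cx c≤d , dy
  ... | inj₂ d≤c = c , cx , arc-growˡ dy d≤c

  common⇔inner : ∀ {x y} → (CommonOut D x y × CommonIn D x y) ⇔ (Inner D x × Inner D y)
  common⇔inner = mk⇔ (common⇒inner {D = D}) λ ((ox , ix) , (oy , iy)) → commonOut ox oy , commonIn ix iy

module FiniteIntervalOrder {n : ℕ} {D : Digraph (Fin n)} (io : IsIntervalOrder D) where
  open IntervalOrder io
  open Data.List.Extrema (DecTotalOrder.totalOrder ≤-decTotalOrder)
    using (argmin; argmax; f[argmin]≤f[xs]; f[xs]≤f[argmax])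

  inner? : Decidable (Inner D)
  inner? x = any? (arc? x) ×-dec any? (λ w → arc? w x)

  -- The argument is only the default element argmin/argmax needs, as Fin n may be empty.
  sink source : Fin n → Fin n
  sink   x = argmin hi x (allFin n)
  source x = argmax lo x (allFin n)

  hasOut⇒arc-sink : ∀ x₀ {x} → HasOut D x → Arc D x (sink x₀)
  hasOut⇒arc-sink x₀ (a , xa) = arc-shrinkʳ xa (lookup (f[argmin]≤f[xs] x₀ (allFin n)) (∈-allFin a))

  hasIn⇒arc-source : ∀ x₀ {x} → HasIn D x → Arc D (source x₀) x
  hasIn⇒arc-source x₀ (b , bx) = arc-growˡ bx (lookup (f[xs]≤f[argmax] x₀ (allFin n)) (∈-allFin b))

  inner⇒two-nonInner : ∀ {x} → Inner D x →
                       Σ (Fin n) λ m → Σ (Fin n) λ M → m ≢ M × ¬ Inner D m × ¬ Inner D M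
  inner⇒two-nonInner {x} (out , in′) = sink x , source x , sink≢source , sink-nonInner , source-nonInner
    where
    sink-nonInner : ¬ Inner D (sink x)
    sink-nonInner (out′ , _) = arc-irrefl (hasOut⇒arc-sink x out′)

    source-nonInner : ¬ Inner D (source x)
    source-nonInner (_ , in″) = arc-irrefl (hasIn⇒arc-source x in″)

    sink≢source : sink x ≢ source x
    sink≢source eq = arc-irrefl (subst (Arc D (source x)) eq
                       (arc-trans (hasIn⇒arc-source x in′) (hasOut⇒arc-sink x out)))

semiorder : (V → ℚ) → ℚ → Digraph V
semiorder f δ = record { Arc = λ x y → f y ℚ.+ δ ℚ.< f x }

semiorder-isSemiorder : {f : V → ℚ} {δ : ℚ} → 0ℚ ℚ.< δ → IsSemiorder (semiorder f δ)
semiorder-isSemiorder {f = f} {δ} δ>0 = f , δ , δ>0 , λ _ _ → mk⇔ id id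

semiorder⇒intervalOrder : {D : Digraph V} → IsSemiorder D → IsIntervalOrder D
semiorder⇒intervalOrder (f , δ , δ>0 , arc⇔) = f , (λ x → f x ℚ.+ δ) , f≤f+δ , arc⇔
  where
  f≤f+δ : ∀ x → f x ℚ.≤ f x ℚ.+ δ
  f≤f+δ x = subst (ℚ._≤ f x ℚ.+ δ) (+-identityʳ (f x)) (+-monoʳ-≤ (f x) (<⇒≤ δ>0))

comap : (V → W) → Digraph W → Digraph V
comap h D = record { Arc = λ x y → Arc D (h x) (h y) }

comap-isSemiorder : {D : Digraph W} (h : V → W) → IsSemiorder D → IsSemiorder (comap h D)
comap-isSemiorder h (f , δ , δ>0 , arc⇔) = f ∘ h , δ , δ>0 , λ x y → arc⇔ (h x) (h y)

module _ {D : Digraph W} {h : V → W} (surj : StrictlySurjective _≡_ h) where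

  commonOut-comap : ∀ {x y} → CommonOut D (h x) (h y) ⇔ CommonOut (comap h D) x y
  commonOut-comap = mk⇔ pull (λ (v , xv , yv) → h v , xv , yv)
    where
    pull : ∀ {x y} → CommonOut D (h x) (h y) → CommonOut (comap h D) x y
    pull (w , xw , yw) with surj w
    ... | v , refl = v , xw , yw

  commonIn-comap : ∀ {x y} → CommonIn D (h x) (h y) ⇔ CommonIn (comap h D) x y
  commonIn-comap = mk⇔ pull (λ (v , vx , vy) → h v , vx , vy)
    where
    pull : ∀ {x y} → CommonIn D (h x) (h y) → CommonIn (comap h D) x y
    pull (w , wx , wy) with surj w
    ... | v , refl = v , wx , wy

comap-isCCEGraphOf : {G : Graph V} {H : Graph W} {D : Digraph W} (φ : V ⤖ W) →
                     (∀ x y → Adj G x y ⇔ Adj H (Bijection.to φ x) (Bijection.to φ y)) →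
                     IsCCEGraphOf H D → IsCCEGraphOf G (comap (Bijection.to φ) D)
comap-isCCEGraphOf {G = G} {H} {D} φ adj⇔ cce x y x≢y = begin
  Adj G x y                                            ∼⟨ adj⇔ x y ⟩
  Adj H (h x) (h y)                                    ∼⟨ cce (h x) (h y) (x≢y ∘ Bijection.injective φ) ⟩
  (CommonOut D (h x) (h y) × CommonIn D (h x) (h y))   ∼⟨ commonOut-comap {D = D} surj ×-⇔ commonIn-comap {D = D} surj ⟩
  (CommonOut (comap h D) x y × CommonIn (comap h D) x y) ∎
  where
  open EquationalReasoning
  h = Bijection.to φ
  surj = Bijection.strictlySurjective φ

level : ∀ {r q} → Fin r ⊎ Fin q → ℚ
level (inj₁ _)       = 1ℚ
level (inj₂ zero)    = + 2 / 1
level (inj₂ (suc _)) = 0ℚ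

levels : (r q : ℕ) → Digraph (Fin r ⊎ Fin q)
levels r q = semiorder level ½

levels-isSemiorder : ∀ {r q} → IsSemiorder (levels r q)
levels-isSemiorder = semiorder-isSemiorder (from-yes (0ℚ ℚ.<? ½))

¬arc-into-top : ∀ {r q} (w : Fin r ⊎ Fin (suc q)) → ¬ Arc (levels r (suc q)) w (inj₂ zero)
¬arc-into-top (inj₁ _)       = from-no (+ 2 / 1 ℚ.+ ½ <? 1ℚ)
¬arc-into-top (inj₂ zero)    = from-no (+ 2 / 1 ℚ.+ ½ <? + 2 / 1)
¬arc-into-top (inj₂ (suc _)) = from-no (+ 2 / 1 ℚ.+ ½ <? 0ℚ)

¬arc-out-of-bottom : ∀ {r q} (k : Fin q) (v : Fin r ⊎ Fin (suc q)) → ¬ Arc (levels r (suc q)) (inj₂ (suc k)) v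
¬arc-out-of-bottom _ (inj₁ _)       = from-no (1ℚ ℚ.+ ½ <? 0ℚ)
¬arc-out-of-bottom _ (inj₂ zero)    = from-no (+ 2 / 1 ℚ.+ ½ <? 0ℚ)
¬arc-out-of-bottom _ (inj₂ (suc _)) = from-no (0ℚ ℚ.+ ½ <? 0ℚ)

inner⇒inj₁ : ∀ {r q} {u : Fin r ⊎ Fin q} → Inner (levels r q) u → IsInj₁ u
inner⇒inj₁ {u = inj₁ _}       _              = tt
inner⇒inj₁ {u = inj₂ zero}    (_ , w , wu)   = ¬arc-into-top w wu
inner⇒inj₁ {u = inj₂ (suc k)} ((v , uv) , _) = ¬arc-out-of-bottom k v uv

inj₁⇒inner : ∀ {r q} {u : Fin r ⊎ Fin q} → 2 ≤ q → IsInj₁ u → Inner (levels r q) u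
inj₁⇒inner {u = inj₁ _} (s≤s (s≤s _)) _ =
  (inj₂ (suc zero) , from-yes (0ℚ ℚ.+ ½ <? 1ℚ)) , (inj₂ zero , from-yes (1ℚ ℚ.+ ½ <? + 2 / 1))

levels-isCCEGraphOf-KI : ∀ {r q} → (2 ≤ r → 2 ≤ q) → IsCCEGraphOf (KI r q) (levels r q)
levels-isCCEGraphOf-KI {r} {q} 2≤r⇒2≤q u v u≢v = mk⇔ adj⇒common common⇒adj
  where
  open IntervalOrder (semiorder⇒intervalOrder (levels-isSemiorder {r} {q}))

  adj⇒common : KI-Adj r q u v → CommonOut (levels r q) u v × CommonIn (levels r q) u v
  adj⇒common uv = Equivalence.from (common⇔inner {u} {v}) (inj₁⇒inner 2≤q iu , inj₁⇒inner 2≤q iv)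
    where
    2≤q = 2≤r⇒2≤q (KI-Adj⇒2≤r uv)
    iu = proj₁ (Equivalence.to (KI-Adj⇔IsInj₁ u≢v) uv)
    iv = proj₂ (Equivalence.to (KI-Adj⇔IsInj₁ u≢v) uv)

  common⇒adj : CommonOut (levels r q) u v × CommonIn (levels r q) u v → KI-Adj r q u v
  common⇒adj c = Equivalence.from (KI-Adj⇔IsInj₁ u≢v)
                   (Product.map (inner⇒inj₁ {u = u}) (inner⇒inj₁ {u = v}) (common⇒inner {D = levels r q} {u} {v} c))

KIShaped : ∀ {n} → Graph (Fin n) → Set
KIShaped G = Σ ℕ λ r → Σ ℕ λ q → (2 ≤ r → 2 ≤ q) × (G ≅ KI r q)

intervalOrder-cceGraph⇒KIShaped : ∀ {n} {G : Graph (Fin n)} {D : Digraph (Fin n)} →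
                                  IsIntervalOrder D → IsCCEGraphOf G D → KIShaped G
intervalOrder-cceGraph⇒KIShaped {G = G} {D} io cce = r , q , 2≤r⇒2≤q , bijection , adj⇔
  where
  open IntervalOrder io
  open FiniteIntervalOrder io
  open Partition (partition inner?)

  distinct-adj⇔ : ∀ {x y} → x ≢ y → Adj G x y ⇔ KI-Adj r q (to x) (to y)
  distinct-adj⇔ {x} {y} x≢y = begin
    Adj G x y                          ∼⟨ cce x y x≢y ⟩
    (CommonOut D x y × CommonIn D x y) ∼⟨ common⇔inner ⟩
    (Inner D x × Inner D y)            ∼⟨ ⇔-sym (inj₁⇔ x ×-⇔ inj₁⇔ y) ⟩
    (IsInj₁ (to x) × IsInj₁ (to y))    ∼⟨ ⇔-sym (KI-Adj⇔IsInj₁ (x≢y ∘ to-injective)) ⟩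
    KI-Adj r q (to x) (to y)           ∎
    where open EquationalReasoning

  adj⇔ : ∀ x y → Adj G x y ⇔ KI-Adj r q (to x) (to y)
  adj⇔ x y = mk⇔ (λ a → Equivalence.to (distinct-adj⇔ (adj⇒≢ G a)) a)
                 (λ k → Equivalence.from (distinct-adj⇔ (adj⇒≢ (KI r q) k ∘ cong to)) k)

  from-inj₁-inner : ∀ i → Inner D (from (inj₁ i))
  from-inj₁-inner i = Equivalence.to (inj₁⇔ _) (subst IsInj₁ (sym (to∘from (inj₁ i))) tt)

  2≤r⇒2≤q : 2 ≤ r → 2 ≤ q
  2≤r⇒2≤q 2≤r with inner⇒two-nonInner (from-inj₁-inner (fromℕ< 2≤r))
  ... | m , M , m≢M , m-nonInner , M-nonInner =
    inj₂-distinct⇒2≤ (m-nonInner ∘ Equivalence.to (inj₁⇔ m)) (M-nonInner ∘ Equivalence.to (inj₁⇔ M))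
                     (m≢M ∘ to-injective)

KIShaped⇒semiorder-cceGraph : ∀ {n} {G : Graph (Fin n)} → KIShaped G →
                              ∃[ D ] (IsSemiorder D × IsCCEGraphOf G D)
KIShaped⇒semiorder-cceGraph {G = G} (r , q , 2≤r⇒2≤q , φ , adj⇔) =
  comap (Bijection.to φ) (levels r q) ,
  comap-isSemiorder {D = levels r q} (Bijection.to φ) (levels-isSemiorder {r} {q}) ,
  comap-isCCEGraphOf {G = G} {H = KI r q} {D = levels r q} φ adj⇔ (levels-isCCEGraphOf-KI 2≤r⇒2≤q)

theorem1p3 : (n : ℕ) (G : Graph (Fin n)) →
    ((∃[ D ] (IsSemiorder D × IsCCEGraphOf G D))
      ⇔ (∃[ D ] (IsIntervalOrder D × IsCCEGraphOf G D)))
    × ((∃[ D ] (IsIntervalOrder D × IsCCEGraphOf G D))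
      ⇔ (Σ ℕ λ r → Σ ℕ λ q → (2 ≤ r → 2 ≤ q) × (G ≅ KI r q)))
theorem1p3 n G = mk⇔ a⇒b (c⇒a ∘ b⇒c) , mk⇔ b⇒c (a⇒b ∘ c⇒a)
  where
  a⇒b : ∃[ D ] (IsSemiorder D × IsCCEGraphOf G D) → ∃[ D ] (IsIntervalOrder D × IsCCEGraphOf G D)
  a⇒b (D , so , cce) = D , semiorder⇒intervalOrder so , cce

  b⇒c : ∃[ D ] (IsIntervalOrder D × IsCCEGraphOf G D) → KIShaped G
  b⇒c (_ , io , cce) = intervalOrder-cceGraph⇒KIShaped {G = G} io cce

  c⇒a : KIShaped G → ∃[ D ] (IsSemiorder D × IsCCEGraphOf G D)
  c⇒a = KIShaped⇒semiorder-cceGraph {G = G}
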